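{- Let $\ell,k$ be positive integers, and let $s$ be the number of distinct prime divisors of $\ell$. Let $\mathcal{F}\subset 2^{[n]}$ be weakly $k$-closed over $\mathbb{Z}_{\ell}$. Then there exists $\mathcal{F}'\subset \mathcal{F}$ such that $|\mathcal{F}'|\geq |\mathcal{F}|-sk^2n$ and $\mathcal{F}'$ is $k$-closed over $\mathbb{Z}_{\ell}$.
   Context: $\mathcal{F}\subset 2^{[n]}$ is weakly $k$-closed over $\mathbb{Z}_\ell$ if the intersection of any $k$ distinct members of $\mathcal{F}$ has size divisible by $\ell$. $\mathcal{F}$ is $k$-closed over $\mathbb{Z}_\ell$ if for every $1\le i\le k$ the intersection of any $i$ not necessarily distinct members of $\mathcal{F}$ has size divisible by $\ell$ (equivalently, any $k$ not necessarily distinct members). -}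

module Defs where

open import Data.Nat using (ℕ; suc; _≤_)
open import Data.Nat.Divisibility using (_∣_; _∣?_)
open import Relation.Binary.PropositionalEquality using (_≡_)
open import Data.Nat.Primality using (prime?)
open import Data.List using (List; length; filter; upTo)
open import Data.List.Membership.Propositional using (_∈_)
open import Data.List.Relation.Unary.All using (All)
open import Data.List.Relation.Unary.Unique.Propositional using (Unique)
open import Data.Fin.Subset using (Subset; ⋂; ∣_∣)
open import Relation.Nullary.Decidable using (_×-dec_)

-- A family F ⊆ 2^[n] is represented by a list of subsets of Fin n without
-- repetitions (Unique); distinct members = distinct list entries.

ω : ℕ → ℕ
ω ℓ = length (filter (λ p → prime? p ×-dec (p ∣? ℓ)) (upTo (suc ℓ)))

WeaklyClosed : ∀ {n} → ℕ → ℕ → List (Subset n) → Set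
WeaklyClosed k ℓ F =
  ∀ (G : List (Subset _)) → length G ≡ k → Unique G → All (_∈ F) G → ℓ ∣ ∣ ⋂ G ∣

Closed : ∀ {n} → ℕ → ℕ → List (Subset n) → Set
Closed k ℓ F =
  ∀ (G : List (Subset _)) → 1 ≤ length G → length G ≤ k → All (_∈ F) G → ℓ ∣ ∣ ⋂ G ∣

module Submission where

-- Descend through t = k − 1, …, 1.  If F is weakly (t+1)-closed, greedily remove pairwise disjoint
-- t-subfamilies T with ℓ ∤ |⋂ T| until what is left is weakly t-closed; each T costs t members.
-- A removed T with first member a yields a prime p with p^e ∥ |⋂ T| and p^(e+1) ∣ ℓ, and for two removed
-- T, T′ with first members a, a′ both ⋂ T ∩ a′ and ⋂ T′ ∩ a are intersections of t + 1 distinct members,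
-- so ℓ divides their sizes.  For a fixed p the Gram matrix of the indicator vectors of the ⋂ T against
-- those of their first members is therefore p-adically dominated by its diagonal, hence nonsingular, so
-- at most n of the T belong to p: a round removes at most t s n members, fewer than s k² n in total.
-- Weak t-closedness for all t ≤ k is closedness, as repeating a member does not change an intersection.

module ListCombinatorics where

  open import Data.Nat.Base using (ℕ; zero; suc; _≤_; _+_; _*_; z≤n; s≤s)
  open import Data.Nat.Properties using (_≟_; +-mono-≤; +-suc; suc-injective; ≤-trans; module ≤-Reasoning)
  open import Data.Fin.Base using (zero; suc)
  open import Data.List.Base using (List; []; _∷_; length; filter; lookup)
  open import Data.List.Relation.Unary.All as All using (All; []; _∷_)
  open import Data.List.Relation.Unary.All.Properties using (all-filter)
  open import Data.List.Relation.Unary.AllPairs using (AllPairs; []; _∷_)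
  open import Data.List.Relation.Binary.Sublist.Propositional using (_⊆_; []; _∷_; _∷ʳ_; ⊆-trans; minimum)
  open import Data.List.Relation.Binary.Sublist.Propositional.Properties using (All-resp-⊆; filter-⊆)
  open import Data.List.Membership.Propositional using (_∈_)
  open import Data.List.Membership.Propositional.Properties using (∈-filter⁻; ∈-filter⁺; ∈-lookup)
  open import Data.List.Relation.Unary.Any as Any using (here; there)
  open import Data.List.Relation.Unary.Unique.Propositional using (Unique)
  open import Data.List.Properties using (filter-notAll)
  open import Data.Product using (∃; _×_; _,_)
  open import Data.Empty using (⊥-elim)
  open import Function using (_∘_; case_of_)
  open import Level using (Level)
  open import Relation.Nullary using (¬_; Dec; yes; no; ¬?)
  open import Relation.Unary using (Pred; Decidable)
  open import Relation.Binary using (Rel; Symmetric; DecidableEquality)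
  open import Relation.Binary.PropositionalEquality

  private variable
    a p r : Level
    A : Set a

  length-filter+filter-¬ : ∀ {P : Pred A p} (P? : Decidable P) xs →
                           length (filter P? xs) + length (filter (¬? ∘ P?) xs) ≡ length xs
  length-filter+filter-¬ P? [] = refl
  length-filter+filter-¬ P? (x ∷ xs) with P? x
  ... | yes _ = cong suc (length-filter+filter-¬ P? xs)
  ... | no _ = trans (+-suc _ _) (cong suc (length-filter+filter-¬ P? xs))

  module _ {R : Rel A r} where

    AllPairs-resp-⊆ : ∀ {xs ys} → ys ⊆ xs → AllPairs R xs → AllPairs R ys
    AllPairs-resp-⊆ [] [] = []
    AllPairs-resp-⊆ (_ ∷ʳ τ) (_ ∷ Rxs) = AllPairs-resp-⊆ τ Rxs
    AllPairs-resp-⊆ (refl ∷ τ) (Rx ∷ Rxs) = All-resp-⊆ τ Rx ∷ AllPairs-resp-⊆ τ Rxs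

    AllPairs-lookup : Symmetric R → ∀ {xs} → AllPairs R xs →
                      ∀ i j → i ≢ j → R (lookup xs i) (lookup xs j)
    AllPairs-lookup sym (Rx ∷ _) zero zero 0≢0 = ⊥-elim (0≢0 refl)
    AllPairs-lookup sym (Rx ∷ _) zero (suc j) _ = All.lookup Rx (∈-lookup j)
    AllPairs-lookup sym (Rx ∷ _) (suc i) zero _ = sym (All.lookup Rx (∈-lookup i))
    AllPairs-lookup sym (_ ∷ Rxs) (suc i) (suc j) i≢j = AllPairs-lookup sym Rxs i j (i≢j ∘ cong suc)

  length-≤-fibres : (f : A → ℕ) (P : List ℕ) {n : ℕ} (xs : List A) → All (λ x → f x ∈ P) xs →
                    (∀ {q ys} → q ∈ P → ys ⊆ xs → All (λ y → f y ≡ q) ys → length ys ≤ n) →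
                    length xs ≤ length P * n
  length-≤-fibres f [] [] _ _ = z≤n
  length-≤-fibres f [] (x ∷ xs) (() ∷ _) _
  length-≤-fibres f (q ∷ P) {n} xs f∈P fibre≤n = begin
    length xs                                                    ≡⟨ length-filter+filter-¬ over-q xs ⟨
    length (filter over-q xs) + length (filter (¬? ∘ over-q) xs) ≤⟨ +-mono-≤ fibre-q others ⟩
    n + length P * n                                             ∎
    where
    open ≤-Reasoning
    over-q : Decidable (λ x → f x ≡ q)
    over-q x = f x ≟ q
    fibre-q : length (filter over-q xs) ≤ n
    fibre-q = fibre≤n (here refl) (filter-⊆ over-q xs) (all-filter over-q xs)
    others∈P : All (λ x → f x ∈ P) (filter (¬? ∘ over-q) xs)
    others∈P = All.tabulate λ x∈others → case ∈-filter⁻ (¬? ∘ over-q) {xs = xs} x∈others of λ where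
      (x∈xs , fx≢q) → case All.lookup f∈P x∈xs of λ where
        (here fx≡q) → ⊥-elim (fx≢q fx≡q)
        (there fx∈P) → fx∈P
    others : length (filter (¬? ∘ over-q) xs) ≤ length P * n
    others = length-≤-fibres f P _ others∈P λ q∈P τ → fibre≤n (there q∈P) (⊆-trans τ (filter-⊆ (¬? ∘ over-q) xs))

  sublist? : {P : Pred (List A) p} → Decidable P → ∀ t xs → Dec (∃ λ ys → ys ⊆ xs × length ys ≡ t × P ys)
  sublist? P? zero xs with P? []
  ... | yes P[] = yes ([] , minimum xs , refl , P[])
  ... | no ¬P[] = no λ { ([] , _ , _ , P[]) → ¬P[] P[] }
  sublist? P? (suc t) [] = no λ { (_ , [] , () , _) }
  sublist? {P = P} P? (suc t) (x ∷ xs) with sublist? {P = P ∘ (x ∷_)} (P? ∘ (x ∷_)) t xs | sublist? P? (suc t) xs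
  ... | yes (ys , τ , |ys|≡t , Pxys) | _ = yes (x ∷ ys , refl ∷ τ , cong suc |ys|≡t , Pxys)
  ... | no _ | yes (ys , τ , |ys|≡1+t , Pys) = yes (ys , x ∷ʳ τ , |ys|≡1+t , Pys)
  ... | no none-with-x | no none-without-x = no λ where
    (ys , _ ∷ʳ τ , |ys|≡1+t , Pys) → none-without-x (ys , τ , |ys|≡1+t , Pys)
    (_ ∷ ys , refl ∷ τ , |xys|≡1+t , Pxys) → none-with-x (ys , τ , suc-injective |xys|≡1+t , Pxys)

  module _ (_≟ᴬ_ : DecidableEquality A) where

    Unique-length-≤ : ∀ {xs ys : List A} → Unique xs → (∀ {x} → x ∈ xs → x ∈ ys) → length xs ≤ length ys
    Unique-length-≤ {[]} _ _ = z≤n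
    Unique-length-≤ {x ∷ xs} {ys} (x∉xs ∷ xs-unique) xs⊆ys =
      ≤-trans (s≤s (Unique-length-≤ xs-unique xs⊆ys-x))
              (filter-notAll not-x ys (Any.map (λ x≡y y≢x → y≢x (sym x≡y)) (xs⊆ys (here refl))))
      where
      not-x : Decidable (_≢ x)
      not-x y = ¬? (y ≟ᴬ x)
      xs⊆ys-x : ∀ {y} → y ∈ xs → y ∈ filter not-x ys
      xs⊆ys-x y∈xs = ∈-filter⁺ not-x (xs⊆ys (there y∈xs)) λ y≡x → All.lookup x∉xs y∈xs (sym y≡x)

module PrimePowers where

  open import Data.Nat.Base
  open import Data.Nat.Properties
  open import Data.Nat.Divisibility
  open import Data.Nat.Induction using (<-wellFounded)
  open import Data.Nat.Primality using (Prime; euclidsLemma; prime⇒irreducible; prime⇒nonZero; ¬prime[1])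
  open import Data.Nat.Primality.Factorisation using (factorise; PrimeFactorisation)
  open import Data.Nat.ListAction using (product)
  open import Data.List.Base using ([]; _∷_)
  open import Data.List.Relation.Unary.All using (All; []; _∷_)
  open import Data.Product using (∃; ∃₂; _×_; _,_; proj₁; proj₂)
  open import Data.Sum using (inj₁; inj₂; [_,_]′)
  open import Data.Nat.Solver using (module +-*-Solver)
  open import Data.Empty using (⊥-elim)
  open import Function using (_∘_)
  open import Induction.WellFounded using (Acc; acc)
  open import Relation.Nullary using (¬_; yes; no)
  open import Relation.Binary.PropositionalEquality

  infix 4 _^_∥_

  _^_∥_ : ℕ → ℕ → ℕ → Set
  p ^ e ∥ d = p ^ e ∣ d × ¬ p ^ suc e ∣ d

  ^-monoʳ-∣ : ∀ p {a b} → a ≤ b → p ^ a ∣ p ^ b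
  ^-monoʳ-∣ p {a} {b} a≤b = divides (p ^ (b ∸ a)) (begin
    p ^ b              ≡⟨ cong (p ^_) (sym (m+[n∸m]≡n a≤b)) ⟩
    p ^ (a + (b ∸ a))  ≡⟨ ^-distribˡ-+-* p a (b ∸ a) ⟩
    p ^ a * p ^ (b ∸ a) ≡⟨ *-comm (p ^ a) _ ⟩
    p ^ (b ∸ a) * p ^ a ∎)
    where open ≡-Reasoning

  p^0∥ : ∀ {p d} → ¬ p ∣ d → p ^ 0 ∥ d
  p^0∥ {p} {d} p∤d = 1∣ d , p∤d ∘ subst (_∣ d) (*-identityʳ p)

  ∥-*p : ∀ {p e d} → .{{NonZero p}} → p ^ e ∥ d → p ^ suc e ∥ d * p
  ∥-*p {p} {e} {d} (p^e∣d , p^1+e∤d) =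
    subst (_∣ d * p) (*-comm (p ^ e) p) (*-monoˡ-∣ p p^e∣d) ,
    p^1+e∤d ∘ *-cancelʳ-∣ p ∘ subst (_∣ d * p) (*-comm p (p ^ suc e))

  exact-power : ∀ p → .{{NonTrivial p}} → ∀ d → .{{NonZero d}} → ∃ λ e → p ^ e ∥ d
  exact-power p d = go d (<-wellFounded d)
    where
    instance _ = nonTrivial⇒nonZero p
    go : ∀ d → .{{NonZero d}} → Acc _<_ d → ∃ λ e → p ^ e ∥ d
    go d (acc smaller) with p ∣? d
    ... | no p∤d = 0 , p^0∥ p∤d
    ... | yes (divides k refl)
      with e , p^e∥k ← go k {{m*n≢0⇒m≢0 k}} (smaller (m<m*n k p {{m*n≢0⇒m≢0 k}} (nonTrivial⇒n>1 p)))
      = suc e , ∥-*p {e = e} p^e∥k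

  -- Junk value 0 at d = 0.
  valuation : ∀ p → .{{NonTrivial p}} → ℕ → ℕ
  valuation p zero = 0
  valuation p d@(suc _) = proj₁ (exact-power p d)

  valuation-∥ : ∀ p → .{{_ : NonTrivial p}} → ∀ d → .{{NonZero d}} → p ^ valuation p d ∥ d
  valuation-∥ p d@(suc _) = proj₂ (exact-power p d)

  ∥-* : ∀ {p a b x y} → Prime p → p ^ a ∥ x → p ^ b ∥ y → p ^ (a + b) ∥ x * y
  ∥-* {p} {a} {b} pr (divides x′ refl , p^1+a∤x) (divides y′ refl , p^1+b∤y) =
    subst (_∣ x′ * p ^ a * (y′ * p ^ b)) (sym (^-distribˡ-+-* p a b)) (*-pres-∣ (n∣m*n x′) (n∣m*n y′)) ,
    λ p^1+a+b∣xy → [ p^1+a∤x ∘ *-monoˡ-∣ (p ^ a) , p^1+b∤y ∘ *-monoˡ-∣ (p ^ b) ]′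
      (euclidsLemma x′ y′ pr (*-cancelʳ-∣ (p ^ (a + b)) {{m^n≢0 p (a + b)}} (subst (p ^ suc (a + b) ∣_) regroup p^1+a+b∣xy)))
    where
    instance _ = prime⇒nonZero pr
    regroup : x′ * p ^ a * (y′ * p ^ b) ≡ x′ * y′ * p ^ (a + b)
    regroup = begin
      x′ * p ^ a * (y′ * p ^ b)  ≡⟨ solve 4 (λ x A y B → (x :* A) :* (y :* B) := (x :* y) :* (A :* B)) refl x′ (p ^ a) y′ (p ^ b) ⟩
      x′ * y′ * (p ^ a * p ^ b)  ≡⟨ cong (x′ * y′ *_) (sym (^-distribˡ-+-* p a b)) ⟩
      x′ * y′ * p ^ (a + b)      ∎
      where open ≡-Reasoning
            open +-*-Solver

  ^∣-cancel-distinct-prime : ∀ {q p} → Prime q → Prime p → q ≢ p → ∀ x {d} → q ^ x ∣ d * p → q ^ x ∣ d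
  ^∣-cancel-distinct-prime qr pr q≢p zero {d} _ = 1∣ d
  ^∣-cancel-distinct-prime {q} {p} qr pr q≢p (suc x) {d} q^1+x∣dp
    with euclidsLemma d p qr (∣-trans (m∣m*n (q ^ x)) q^1+x∣dp)
  ... | inj₂ q∣p = ⊥-elim ([ (λ { refl → ¬prime[1] qr }) , q≢p ]′ (prime⇒irreducible pr q∣p))
  ... | inj₁ (divides d′ refl) =
    subst (q ^ suc x ∣_) (*-comm q d′) (*-monoʳ-∣ q (^∣-cancel-distinct-prime qr pr q≢p x q^x∣d′p))
    where
    instance _ = prime⇒nonZero qr
    q^x∣d′p : q ^ x ∣ d′ * p
    q^x∣d′p = *-cancelˡ-∣ q (subst (q ^ suc x ∣_) (trans (cong (_* p) (*-comm d′ q)) (*-assoc q d′ p)) q^1+x∣dp)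

  PrimePowerGap : ℕ → ℕ → Set
  PrimePowerGap ℓ d = ∃₂ λ p e → Prime p × p ^ e ∥ d × p ^ suc e ∣ ℓ

  product-gap : ∀ {ps} → All Prime ps → ∀ d → ¬ product ps ∣ d → PrimePowerGap (product ps) d
  product-gap [] d ∤d = ⊥-elim (∤d (1∣ d))
  product-gap {p ∷ ps} (pr ∷ prs) d ∤d with p ∣? d
  ... | no p∤d = p , 0 , pr , p^0∥ p∤d , subst (_∣ p * product ps) (sym (*-identityʳ p)) (m∣m*n (product ps))
  ... | yes (divides d′ refl)
      with q , e , qr , q^e∥d′ , q^1+e∣ ←
             product-gap prs d′ (∤d ∘ subst (p * product ps ∣_) (*-comm p d′) ∘ *-monoʳ-∣ p)
      with q ≟ p
  ...   | yes refl = p , suc e , pr , ∥-*p {e = e} q^e∥d′ , *-monoʳ-∣ p q^1+e∣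
    where instance _ = prime⇒nonZero pr
  ...   | no q≢p = q , e , qr , (∣m⇒∣m*n p (proj₁ q^e∥d′) , proj₂ q^e∥d′ ∘ ^∣-cancel-distinct-prime qr pr q≢p (suc e)) ,
                   ∣n⇒∣m*n p q^1+e∣

  ∤⇒prime-power-gap : ∀ ℓ → .{{NonZero ℓ}} → ∀ d → ¬ ℓ ∣ d → PrimePowerGap ℓ d
  ∤⇒prime-power-gap ℓ d ℓ∤d =
    subst (λ m → PrimePowerGap m d) (sym ℓ≡∏) (product-gap factorsPrime d (ℓ∤d ∘ subst (_∣ d) (sym ℓ≡∏)))
    where open PrimeFactorisation (factorise ℓ) renaming (isFactorisation to ℓ≡∏)

module IntegerLinearAlgebra where

  open import Data.Nat.Base as ℕ using (ℕ; zero; suc; s≤s)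
  open import Data.Nat.Properties using (m<n⇒m<1+n)
  open import Data.Integer.Base using (ℤ; 0ℤ; 1ℤ; _*_; _+_; -_; _-_)
  import Data.Integer.Properties as ℤ
  open import Data.Integer.Solver using (module +-*-Solver)
  open import Data.Fin.Base using (Fin; zero; suc; punchIn)
  open import Data.Fin.Properties using (any?)
  open import Data.Vec.Functional using (insertAt)
  open import Data.Vec.Functional.Properties using (insertAt-lookup; insertAt-punchIn)
  open import Algebra.Properties.Semiring.Sum ℤ.+-*-semiring
  open import Data.Product using (Σ; ∃; _×_; _,_)
  open import Data.Sum using ([_,_]′)
  open import Relation.Nullary using (¬_; yes; no; ¬?)
  open import Relation.Nullary.Decidable using (decidable-stable)
  open import Relation.Binary.PropositionalEquality

  combination : ∀ {m n} → (Fin m → ℤ) → (Fin m → Fin n → ℤ) → Fin n → ℤ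
  combination c u x = sum λ j → c j * u j x

  LinearDependence : ∀ {m n} → (Fin m → Fin n → ℤ) → Set
  LinearDependence u = Σ _ λ c → (∃ λ j → c j ≢ 0ℤ) × (∀ x → combination c u x ≡ 0ℤ)

  sum-zero : ∀ {m} {f : Fin m → ℤ} → (∀ j → f j ≡ 0ℤ) → sum f ≡ 0ℤ
  sum-zero {m} f≗0 = trans (sum-cong-≗ f≗0) (sum-replicate-zero m)

  module Pivot {m n} (u : Fin (suc m) → Fin n → ℤ) (j₀ : Fin (suc m)) (x₀ : Fin n) where

    pivot : ℤ
    pivot = u j₀ x₀

    eliminated : Fin m → Fin n → ℤ
    eliminated i x = pivot * u (punchIn j₀ i) x - u (punchIn j₀ i) x₀ * u j₀ x

    eliminated-pivot : ∀ i → eliminated i x₀ ≡ 0ℤ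
    eliminated-pivot i = solve 2 (λ a b → a :* b :- b :* a := con 0ℤ) refl pivot (u (punchIn j₀ i) x₀)
      where open +-*-Solver

    -- The relation Σᵢ dᵢ · eliminated i, regrouped by the vectors u j.
    lift : (Fin m → ℤ) → Fin (suc m) → ℤ
    lift d = insertAt (λ i → pivot * d i) j₀ (sum λ i → - (d i * u (punchIn j₀ i) x₀))

    lift-≢0 : pivot ≢ 0ℤ → ∀ {d} → ∃ (λ i → d i ≢ 0ℤ) → ∃ λ j → lift d j ≢ 0ℤ
    lift-≢0 pivot≢0 {d} (i , dᵢ≢0) = punchIn j₀ i , λ eq →
      [ pivot≢0 , dᵢ≢0 ]′ (ℤ.i*j≡0⇒i≡0∨j≡0 pivot (trans (sym (insertAt-punchIn _ j₀ _ i)) eq))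

    combination-lift : ∀ d x → combination (lift d) u x ≡ combination d eliminated x
    combination-lift d x = begin
      combination (lift d) u x
        ≡⟨ sum-remove {i = j₀} (λ j → lift d j * u j x) ⟩
      lift d j₀ * u j₀ x + sum (λ i → lift d (punchIn j₀ i) * u (punchIn j₀ i) x)
        ≡⟨ cong₂ (λ s t → s * u j₀ x + t) (insertAt-lookup _ j₀ _)
                 (sum-cong-≗ λ i → cong (_* u (punchIn j₀ i) x) (insertAt-punchIn _ j₀ _ i)) ⟩
      sum negated * u j₀ x + sum kept
        ≡⟨ cong (_+ sum kept) (*-distribʳ-sum (u j₀ x) negated) ⟩
      sum (λ i → negated i * u j₀ x) + sum kept
        ≡⟨ ℤ.+-comm (sum λ i → negated i * u j₀ x) (sum kept) ⟩
      sum kept + sum (λ i → negated i * u j₀ x)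
        ≡⟨ ∑-distrib-+ kept (λ i → negated i * u j₀ x) ⟨
      sum (λ i → kept i + negated i * u j₀ x)
        ≡⟨ sum-cong-≗ (λ i → solve 5 (λ P D A a b → P :* D :* A :+ :- (D :* a) :* b := D :* (P :* A :- a :* b))
                                refl pivot (d i) (u (punchIn j₀ i) x) (u (punchIn j₀ i) x₀) (u j₀ x)) ⟩
      combination d eliminated x ∎
      where
      open ≡-Reasoning
      open +-*-Solver
      negated kept : Fin m → ℤ
      negated i = - (d i * u (punchIn j₀ i) x₀)
      kept i = pivot * d i * u (punchIn j₀ i) x

  linearDependence : ∀ {m n} → n ℕ.< m → (u : Fin m → Fin n → ℤ) → LinearDependence u
  linearDependence {suc m} {zero} _ u = (λ _ → 1ℤ) , (zero , λ ()) , λ ()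
  linearDependence {suc m} {suc n} (s≤s n<m) u with any? (λ j → ¬? (u j zero ℤ.≟ 0ℤ))
  ... | no no-pivot with c , c≢0 , rel ← linearDependence (m<n⇒m<1+n n<m) (λ j x → u j (suc x))
    = c , c≢0 , λ { zero → sum-zero (λ j → trans (cong (c j *_) (first-column-zero j)) (ℤ.*-zeroʳ (c j)))
                  ; (suc x) → rel x }
    where
    first-column-zero : ∀ j → u j zero ≡ 0ℤ
    first-column-zero j = decidable-stable (u j zero ℤ.≟ 0ℤ) (λ uⱼ≢0 → no-pivot (j , uⱼ≢0))
  ... | yes (j₀ , pivot≢0) with d , d≢0 , rel ← linearDependence n<m (λ i x → Pivot.eliminated u j₀ zero i (suc x))
    = lift d , lift-≢0 pivot≢0 d≢0 , λ x → trans (combination-lift d x) (eliminated-relation x)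
    where
    open Pivot u j₀ zero
    eliminated-relation : ∀ x → combination d eliminated x ≡ 0ℤ
    eliminated-relation zero = sum-zero (λ i → trans (cong (d i *_) (eliminated-pivot i)) (ℤ.*-zeroʳ (d i)))
    eliminated-relation (suc x) = rel x

module PAdicGram where

  open import Data.Nat.Base using (ℕ; zero; suc; s≤s; _≤_; _<_; _^_) renaming (_+_ to _+ℕ_; _*_ to _*ℕ_)
  open import Data.Nat.Properties using (≮⇒≥; ≰⇒>; _<?_; _≤?_; +-suc; ^-distribˡ-+-*)
  open import Data.Nat.Divisibility using (_∣_; ∣-trans; _∣0; *-pres-∣)
  open import Data.Nat.Induction using (<-wellFounded)
  open import Data.Nat.Primality using (Prime; prime⇒nonTrivial)
  open import Data.Integer.Base using (ℤ; +_; 0ℤ; _*_; ∣_∣; ≢-nonZero)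
  import Data.Integer.Properties as ℤ
  open import Data.Integer.Divisibility.Signed using (∣ᵤ⇒∣; ∣⇒∣ᵤ; ∣m+n∣n⇒∣m; ∣m∣n⇒∣m+n) renaming (_∣_ to _∣ℤ_)
  open import Data.Fin.Base using (Fin; zero; suc; punchIn)
  open import Data.Fin.Properties using (any?; punchInᵢ≢i)
  open import Algebra.Properties.Semiring.Sum ℤ.+-*-semiring
  open import Data.Product using (∃; _×_; _,_; proj₁; proj₂)
  open import Data.Empty using (⊥-elim)
  open import Function using (_∘_)
  open import Induction.WellFounded using (Acc; acc)
  open import Relation.Nullary using (¬_; ¬?; yes; no)
  open import Relation.Nullary.Decidable using (_×-dec_)
  open import Level using (0ℓ)
  open import Relation.Unary using (Pred; Decidable)
  open import Relation.Binary.PropositionalEquality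

  open PrimePowers
  open IntegerLinearAlgebra

  minimizer : ∀ {m} {P : Pred (Fin m) 0ℓ} → Decidable P → (f : Fin m → ℕ) →
              ∃ P → ∃ λ k → P k × ∀ j → P j → f k ≤ f j
  minimizer {P = P} P? f (j , Pj) = go j Pj (<-wellFounded (f j))
    where
    go : ∀ j → P j → Acc _<_ (f j) → ∃ λ k → P k × ∀ j → P j → f k ≤ f j
    go j Pj (acc smaller) with any? (λ i → P? i ×-dec f i <? f j)
    ... | no none = j , Pj , λ i Pi → ≮⇒≥ (λ fᵢ<fⱼ → none (i , Pi , fᵢ<fⱼ))
    ... | yes (i , Pi , fᵢ<fⱼ) = go i Pi (smaller fᵢ<fⱼ)

  sum-∣ : ∀ {m} d (g : Fin m → ℤ) → (∀ i → d ∣ℤ g i) → d ∣ℤ sum g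
  sum-∣ {zero} d g _ = ∣ᵤ⇒∣ (_ ∣0)
  sum-∣ {suc m} d g d∣g = ∣m∣n⇒∣m+n (d∣g zero) (sum-∣ d (g ∘ suc) (d∣g ∘ suc))

  DominantDiagonal : ∀ {m} → ℕ → (Fin m → ℕ) → (Fin m → Fin m → ℤ) → Set
  DominantDiagonal p e G = (∀ j → p ^ e j ∥ ∣ G j j ∣) × (∀ j k → j ≢ k → p ^ suc (e j) ∣ ∣ G j k ∣)

  dominantDiagonal⇒trivialLeftKernel : ∀ {p m e} {G : Fin m → Fin m → ℤ} → Prime p → DominantDiagonal p e G →
    (c : Fin m → ℤ) → (∀ k → sum (λ j → c j * G j k) ≡ 0ℤ) → ¬ ∃ λ j → c j ≢ 0ℤ
  dominantDiagonal⇒trivialLeftKernel {m = zero} _ _ _ _ (() , _)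
  -- For k minimising v_p(c j) + e j over c j ≢ 0, every term j ≢ k of Σⱼ c j G j k is divisible by
  -- p^(1 + v_p(c k) + e k), hence so is c k G k k, which has valuation exactly v_p(c k) + e k.
  dominantDiagonal⇒trivialLeftKernel {p} {suc m} {e} {G} pr (diagonal , off-diagonal) c cG≡0 c≢0 =
    proj₂ (∥-* {a = v k} {b = e k} pr (valuation-∥ p ∣ c k ∣ {{≢-nonZero cₖ≢0}}) (diagonal k))
            (subst (p ^ suc (v k +ℕ e k) ∣_) (ℤ.abs-* (c k) (G k k)) (∣⇒∣ᵤ diagonal-term))
    where
    instance _ = prime⇒nonTrivial pr
    v : Fin (suc m) → ℕ
    v j = valuation p ∣ c j ∣
    minimum : ∃ λ k → c k ≢ 0ℤ × ∀ j → c j ≢ 0ℤ → v k +ℕ e k ≤ v j +ℕ e j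
    minimum = minimizer (λ j → ¬? (c j ℤ.≟ 0ℤ)) (λ j → v j +ℕ e j) c≢0
    k : Fin (suc m)
    k = proj₁ minimum
    cₖ≢0 : c k ≢ 0ℤ
    cₖ≢0 = proj₁ (proj₂ minimum)
    minimal : ∀ j → c j ≢ 0ℤ → v k +ℕ e k ≤ v j +ℕ e j
    minimal = proj₂ (proj₂ minimum)
    D : ℤ
    D = + p ^ suc (v k +ℕ e k)
    off-diagonal-term : ∀ j → j ≢ k → D ∣ℤ c j * G j k
    off-diagonal-term j j≢k with c j ℤ.≟ 0ℤ
    ... | yes cⱼ≡0 rewrite cⱼ≡0 = ∣ᵤ⇒∣ (_ ∣0)
    ... | no cⱼ≢0 = ∣ᵤ⇒∣ (subst (_ ∣_) (sym (ℤ.abs-* (c j) (G j k)))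
          (∣-trans (^-monoʳ-∣ p (subst (suc (v k +ℕ e k) ≤_) (sym (+-suc (v j) (e j))) (s≤s (minimal j cⱼ≢0))))
            (subst (_∣ ∣ c j ∣ *ℕ ∣ G j k ∣) (sym (^-distribˡ-+-* p (v j) (suc (e j))))
              (*-pres-∣ (proj₁ (valuation-∥ p ∣ c j ∣ {{≢-nonZero cⱼ≢0}})) (off-diagonal j k j≢k)))))
    diagonal-term : D ∣ℤ c k * G k k
    diagonal-term = ∣m+n∣n⇒∣m (subst (D ∣ℤ_) (trans (sym (cG≡0 k)) (sum-remove {i = k} (λ j → c j * G j k))) (∣ᵤ⇒∣ (_ ∣0)))
                              (sum-∣ D _ (λ i → off-diagonal-term (punchIn k i) (punchInᵢ≢i k i)))

  infix 7 _·_

  _·_ : ∀ {n} → (Fin n → ℤ) → (Fin n → ℤ) → ℤ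
  u · w = sum λ x → u x * w x

  combination-· : ∀ {m n} (c : Fin m → ℤ) (u : Fin m → Fin n → ℤ) (w : Fin n → ℤ) →
                  sum (λ j → c j * (u j · w)) ≡ combination c u · w
  combination-· c u w = begin
    sum (λ j → c j * sum (λ x → u j x * w x))    ≡⟨ sum-cong-≗ (λ j → *-distribˡ-sum (c j) (λ x → u j x * w x)) ⟩
    sum (λ j → sum (λ x → c j * (u j x * w x)))  ≡⟨ ∑-comm (λ j x → c j * (u j x * w x)) ⟩
    sum (λ x → sum (λ j → c j * (u j x * w x)))  ≡⟨ sum-cong-≗ (λ x → sum-cong-≗ (λ j → sym (ℤ.*-assoc (c j) (u j x) (w x)))) ⟩
    sum (λ x → sum (λ j → c j * u j x * w x))    ≡⟨ sum-cong-≗ (λ x → sym (*-distribʳ-sum (w x) (λ j → c j * u j x))) ⟩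
    combination c u · w                          ∎
    where open ≡-Reasoning

  gram-bound : ∀ {p m n e} → Prime p → (u w : Fin m → Fin n → ℤ) →
               DominantDiagonal p e (λ j k → u j · w k) → m ≤ n
  gram-bound {m = m} {n} {e} pr u w dominant with m ≤? n
  ... | yes m≤n = m≤n
  ... | no m≰n with c , c≢0 , cu≡0 ← linearDependence (≰⇒> m≰n) u =
    ⊥-elim (dominantDiagonal⇒trivialLeftKernel {e = e} pr dominant c cuw≡0 c≢0)
    where
    cuw≡0 : ∀ k → sum (λ j → c j * (u j · w k)) ≡ 0ℤ
    cuw≡0 k = trans (combination-· c u (w k))
                    (sum-zero (λ x → trans (cong (_* w k x) (cu≡0 x)) (ℤ.*-zeroˡ (w k x))))

module MarkedFamilies where

  open import Data.Nat.Base using (ℕ; suc; s≤s; _≤_; _^_; _*_; NonZero)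
  open import Data.Nat.Divisibility using (_∣_; _∣?_; ∣-trans; m∣m*n; ∣⇒≤)
  open import Data.Nat.Primality using (Prime; prime?)
  open import Data.Integer.Base as ℤ using (ℤ; +_; 1ℤ; 0ℤ)
  open import Data.Bool.Base using (true; false; if_then_else_)
  open import Data.Vec.Base using ([]; _∷_) renaming (lookup to lookupᵥ)
  open import Data.Fin.Base using (Fin)
  open import Data.Fin.Subset using (Subset; ∣_∣; _∩_)
  open import Data.List.Base using (List; length; lookup; filter; upTo)
  open import Data.List.Relation.Unary.All as All using (All)
  open import Data.List.Relation.Unary.AllPairs using (AllPairs)
  open import Data.List.Membership.Propositional using (_∈_)
  open import Data.List.Membership.Propositional.Properties using (∈-lookup; ∈-filter⁺; ∈-filter⁻; ∈-upTo⁺)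
  open import Data.Product using (_×_; _,_; proj₁; proj₂; swap)
  open import Relation.Nullary.Decidable using (_×-dec_)
  open import Relation.Unary using (Decidable)
  open import Relation.Binary.PropositionalEquality
  open import Function using (_∘_)

  open import Defs using (ω)
  open PrimePowers
  open PAdicGram
  open ListCombinatorics

  𝟙 : ∀ {n} → Subset n → Fin n → ℤ
  𝟙 a x = if lookupᵥ a x then 1ℤ else 0ℤ

  𝟙·𝟙 : ∀ {n} (a b : Subset n) → 𝟙 a · 𝟙 b ≡ + ∣ a ∩ b ∣
  𝟙·𝟙 [] [] = refl
  𝟙·𝟙 (true ∷ a) (true ∷ b) rewrite 𝟙·𝟙 a b = refl
  𝟙·𝟙 (true ∷ a) (false ∷ b) rewrite 𝟙·𝟙 a b = refl
  𝟙·𝟙 (false ∷ a) (true ∷ b) rewrite 𝟙·𝟙 a b = refl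
  𝟙·𝟙 (false ∷ a) (false ∷ b) rewrite 𝟙·𝟙 a b = refl

  record Marked (n ℓ : ℕ) : Set where
    field
      U A : Subset n
      p e : ℕ
      p-prime : Prime p
      exact : p ^ e ∥ ∣ U ∩ A ∣
      gap : p ^ suc e ∣ ℓ

  open Marked

  Orthogonal : ∀ {n ℓ} → Marked n ℓ → Marked n ℓ → Set
  Orthogonal {ℓ = ℓ} X Y = (ℓ ∣ ∣ U X ∩ A Y ∣) × (ℓ ∣ ∣ U Y ∩ A X ∣)

  same-prime-bound : ∀ {n ℓ q} → Prime q → (Xs : List (Marked n ℓ)) → All (λ X → p X ≡ q) Xs →
                     AllPairs Orthogonal Xs → length Xs ≤ n
  same-prime-bound {q = q} q-prime Xs p≡q orthogonal = gram-bound {e = e ∘ lookup Xs} q-prime u w (diagonal , off-diagonal)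
    where
    u w : Fin (length Xs) → Fin _ → ℤ
    u j = 𝟙 (U (lookup Xs j))
    w j = 𝟙 (A (lookup Xs j))
    diagonal : ∀ j → q ^ e (lookup Xs j) ∥ ℤ.∣ u j · w j ∣
    diagonal j = subst (λ g → q ^ e X ∥ ℤ.∣ g ∣) (sym (𝟙·𝟙 (U X) (A X)))
                       (subst (λ r → r ^ e X ∥ ∣ U X ∩ A X ∣) (All.lookup p≡q (∈-lookup j)) (exact X))
      where X = lookup Xs j
    off-diagonal : ∀ j k → j ≢ k → q ^ suc (e (lookup Xs j)) ∣ ℤ.∣ u j · w k ∣
    off-diagonal j k j≢k = subst (λ g → q ^ suc (e X) ∣ ℤ.∣ g ∣) (sym (𝟙·𝟙 (U X) (A Y)))
      (∣-trans (subst (λ r → r ^ suc (e X) ∣ _) (All.lookup p≡q (∈-lookup j)) (gap X))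
               (proj₁ (AllPairs-lookup swap orthogonal j k j≢k)))
      where X = lookup Xs j
            Y = lookup Xs k

  marked-family-bound : ∀ {n ℓ} → .{{NonZero ℓ}} → (Xs : List (Marked n ℓ)) →
                        AllPairs Orthogonal Xs → length Xs ≤ ω ℓ * n
  marked-family-bound {n} {ℓ} Xs orthogonal =
    length-≤-fibres p primes Xs (All.tabulate λ {X} _ → p∈primes X)
      λ q∈primes τ p≡q → same-prime-bound (proj₁ (proj₂ (∈-filter⁻ prime-divisor? {xs = upTo (suc ℓ)} q∈primes)))
                                          _ p≡q (AllPairs-resp-⊆ τ orthogonal)
    where
    prime-divisor? : Decidable (λ q → Prime q × q ∣ ℓ)
    prime-divisor? q = prime? q ×-dec (q ∣? ℓ)
    primes : List ℕ
    primes = filter prime-divisor? (upTo (suc ℓ))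
    p∈primes : ∀ X → p X ∈ primes
    p∈primes X = ∈-filter⁺ prime-divisor? (∈-upTo⁺ (s≤s (∣⇒≤ p∣ℓ))) (p-prime X , p∣ℓ)
      where p∣ℓ = ∣-trans (m∣m*n (p X ^ e X)) (gap X)

module WeakClosure where

  open import Data.Nat.Base using (ℕ; _≤_)
  open import Data.Nat.Properties using (≤-antisym; ≤-trans)
  open import Data.Nat.Divisibility using (_∣_; _∣?_)
  open import Data.Bool.Properties using () renaming (_≟_ to _≟ᴮ_)
  open import Data.Vec.Properties using (≡-dec)
  open import Data.Fin.Subset as S using (Subset; ⋂; ∣_∣; _∩_)
  import Data.Fin.Subset.Properties as S
  open import Data.List.Base using (List; []; _∷_; length; filter)
  open import Data.List.Relation.Unary.All as All using (All; []; _∷_)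
  open import Data.List.Relation.Unary.Any as Any using (here; there)
  open import Data.List.Properties using (filter-some)
  open import Data.List.Relation.Unary.Unique.Propositional using (Unique)
  open import Data.List.Relation.Binary.Sublist.Propositional using (_⊆_; lookup)
  open import Data.List.Relation.Binary.Sublist.Propositional.Properties using (filter-⊆)
  open import Data.List.Membership.Propositional using (_∈_)
  open import Data.List.Membership.Propositional.Properties using (∈-filter⁺; ∈-filter⁻)
  open import Data.Product using (∃; _×_; _,_; proj₁; proj₂)
  open import Data.Sum using (_⊎_; inj₁; inj₂)
  open import Relation.Nullary using (¬_; yes; no; ¬?)
  open import Relation.Nullary.Decidable using (decidable-stable)
  open import Relation.Binary using (DecidableEquality)
  open import Relation.Binary.PropositionalEquality

  open import Defs using (WeaklyClosed; Closed)
  open ListCombinatorics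

  module _ {n : ℕ} where

    _≟ˢ_ : DecidableEquality (Subset n)
    _≟ˢ_ = ≡-dec _≟ᴮ_

    open import Data.List.Membership.DecPropositional _≟ˢ_ public using (_∈?_)

    ∈⋂⁻ : ∀ {x} (G : List (Subset n)) → x S.∈ ⋂ G → All (x S.∈_) G
    ∈⋂⁻ [] _ = []
    ∈⋂⁻ (a ∷ G) x∈a∩⋂G = proj₁ (S.x∈p∩q⁻ a (⋂ G) x∈a∩⋂G) ∷ ∈⋂⁻ G (proj₂ (S.x∈p∩q⁻ a (⋂ G) x∈a∩⋂G))

    ∈⋂⁺ : ∀ {x} (G : List (Subset n)) → All (x S.∈_) G → x S.∈ ⋂ G
    ∈⋂⁺ [] [] = S.∈⊤
    ∈⋂⁺ (a ∷ G) (x∈a ∷ x∈G) = S.x∈p∩q⁺ (x∈a , ∈⋂⁺ G x∈G)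

    ⋂-antitone : ∀ {G G′ : List (Subset n)} → (∀ {a} → a ∈ G′ → a ∈ G) → ⋂ G S.⊆ ⋂ G′
    ⋂-antitone {G} {G′} G′⊆G x∈⋂G = ∈⋂⁺ G′ (All.tabulate λ a∈G′ → All.lookup (∈⋂⁻ G x∈⋂G) (G′⊆G a∈G′))

    ⋂-cong : ∀ {G G′ : List (Subset n)} → (∀ {a} → a ∈ G → a ∈ G′) → (∀ {a} → a ∈ G′ → a ∈ G) → ⋂ G ≡ ⋂ G′
    ⋂-cong G⊆G′ G′⊆G = S.⊆-antisym (⋂-antitone G′⊆G) (⋂-antitone G⊆G′)

    ⋂∩-member : ∀ {a} G → a ∈ G → ⋂ G ∩ a ≡ ⋂ G
    ⋂∩-member {a} G a∈G =
      trans (S.∩-comm (⋂ G) a) (⋂-cong {a ∷ G} {G} (λ { (here refl) → a∈G ; (there b∈G) → b∈G }) there)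

    select : List (Subset n) → List (Subset n) → List (Subset n)
    select G H = filter (_∈? G) H

    select-⊆ : ∀ G H → select G H ⊆ H
    select-⊆ G H = filter-⊆ (_∈? G) H

    ∈-select⁻ : ∀ {G H a} → a ∈ select G H → a ∈ G
    ∈-select⁻ {G} {H} a∈ = proj₂ (∈-filter⁻ (_∈? G) {xs = H} a∈)

    ⋂-select : ∀ {G H} → All (_∈ H) G → ⋂ (select G H) ≡ ⋂ G
    ⋂-select {G} {H} G⊆H = ⋂-cong (∈-select⁻ {G} {H}) λ a∈G → ∈-filter⁺ (_∈? G) (All.lookup G⊆H a∈G) a∈G

    select-unique : ∀ {G H} → Unique H → Unique (select G H)
    select-unique {G} {H} H-unique = AllPairs-resp-⊆ (select-⊆ G H) H-unique

    length-select-≤ : ∀ {G H} → Unique H → length (select G H) ≤ length G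
    length-select-≤ {G} {H} H-unique = Unique-length-≤ _≟ˢ_ (select-unique H-unique) (∈-select⁻ {G} {H})

    length-select : ∀ {G H} → Unique G → Unique H → All (_∈ H) G → length (select G H) ≡ length G
    length-select {G} {H} G-unique H-unique G⊆H = ≤-antisym (length-select-≤ {G} H-unique)
      (Unique-length-≤ _≟ˢ_ G-unique λ a∈G → ∈-filter⁺ (_∈? G) (All.lookup G⊆H a∈G) a∈G)

    WeaklyClosed-resp-⊆ : ∀ {t ℓ} {H H′ : List (Subset n)} → H′ ⊆ H → WeaklyClosed t ℓ H → WeaklyClosed t ℓ H′
    WeaklyClosed-resp-⊆ H′⊆H closed G |G|≡t G-unique G⊆H′ = closed G |G|≡t G-unique (All.map (lookup H′⊆H) G⊆H′)

    weaklyClosed⊎violation : ∀ t ℓ {H} → Unique H →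
                             WeaklyClosed t ℓ H ⊎ ∃ λ T → T ⊆ H × length T ≡ t × ¬ ℓ ∣ ∣ ⋂ T ∣
    weaklyClosed⊎violation t ℓ {H} H-unique with sublist? (λ T → ¬? (ℓ ∣? ∣ ⋂ T ∣)) t H
    ... | yes violation = inj₂ violation
    ... | no no-violation = inj₁ λ G |G|≡t G-unique G⊆H →
      subst (λ X → ℓ ∣ ∣ X ∣) (⋂-select G⊆H) (decidable-stable (ℓ ∣? ∣ ⋂ (select G H) ∣) λ ℓ∤ →
        no-violation (select G H , select-⊆ G H , trans (length-select G-unique H-unique G⊆H) |G|≡t , ℓ∤))

    weaklyClosed⇒closed : ∀ {k ℓ H} → Unique H → (∀ t → 1 ≤ t → t ≤ k → WeaklyClosed t ℓ H) → Closed k ℓ H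
    weaklyClosed⇒closed {H = H} H-unique closed G@(g ∷ _) _ |G|≤k G⊆H =
      subst (λ X → _ ∣ ∣ X ∣) (⋂-select G⊆H)
        (closed _ (filter-some (_∈? G) (Any.map (λ g≡h → subst (_∈ G) g≡h (here refl)) (All.lookup G⊆H (here refl))))
                  (≤-trans (length-select-≤ {G} H-unique) |G|≤k)
                (select G H) refl (select-unique H-unique) (All.tabulate (lookup (select-⊆ G H))))

module Greedy where

  open import Data.Nat.Base using (ℕ; suc; _≤_; _<_; _+_; _*_)
  open import Data.Nat.Properties using (≤-reflexive; *-zeroʳ; +-identityʳ; +-mono-≤; module ≤-Reasoning)
  open import Data.Nat.Solver using (module +-*-Solver)
  open import Data.Nat.Induction using (<-wellFounded)
  open import Data.Nat.Divisibility using (_∣_)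
  open import Data.Fin.Subset using (Subset; ⋂; ∣_∣)
  open import Data.List.Base using (List; []; _∷_; length; filter)
  open import Data.List.Properties using (filter-notAll)
  open import Data.List.Relation.Unary.All as All using (All; []; _∷_)
  open import Data.List.Relation.Unary.AllPairs using (AllPairs; []; _∷_)
  open import Data.List.Relation.Unary.Any as Any using (here)
  open import Data.List.Relation.Unary.Unique.Propositional using (Unique)
  open import Data.List.Relation.Binary.Sublist.Propositional using (_⊆_; ⊆-refl; ⊆-trans; lookup)
  open import Data.List.Relation.Binary.Sublist.Propositional.Properties using (filter-⊆)
  open import Data.List.Relation.Binary.Disjoint.Propositional using (Disjoint)
  open import Data.List.Membership.Propositional using (_∈_)
  open import Data.List.Membership.Propositional.Properties using (∈-filter⁻)
  open import Data.Product using (∃; _×_; _,_; proj₂)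
  open import Data.Sum using (inj₁; inj₂)
  open import Function using (_∘_)
  open import Induction.WellFounded using (Acc; acc)
  open import Relation.Nullary using (¬_; ¬?)
  open import Relation.Binary.PropositionalEquality

  open import Defs using (WeaklyClosed)
  open ListCombinatorics
  open WeakClosure

  Violation : ∀ {n} → ℕ → ℕ → List (Subset n) → List (Subset n) → Set
  Violation i ℓ H T = T ⊆ H × length T ≡ i × ¬ ℓ ∣ ∣ ⋂ T ∣

  record Reduction {n} (i ℓ : ℕ) (H : List (Subset n)) : Set where
    field
      kept : List (Subset n)
      kept⊆H : kept ⊆ H
      kept-closed : WeaklyClosed i ℓ kept
      removed : List (List (Subset n))
      removed-violations : All (Violation i ℓ H) removed
      removed-disjoint : AllPairs Disjoint removed
      size : length H ≤ length kept + i * length removed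

  reduce : ∀ {n} i ℓ → (H : List (Subset n)) → Unique H → Reduction (suc i) ℓ H
  reduce {n} i ℓ H H-unique = go H H-unique (<-wellFounded (length H))
    where
    open Reduction
    nonempty : ∀ {T : List (Subset n)} → length T ≡ suc i → ∃ (_∈ T)
    nonempty {[]} ()
    nonempty {t ∷ _} _ = t , here refl
    go : (H : List (Subset n)) → Unique H → Acc _<_ (length H) → Reduction (suc i) ℓ H
    go H H-unique (acc shorter) with weaklyClosed⊎violation (suc i) ℓ H-unique
    ... | inj₁ closed = record
      { kept = H ; kept⊆H = ⊆-refl ; kept-closed = closed ; removed = [] ; removed-violations = [] ; removed-disjoint = []
      ; size = ≤-reflexive (sym (trans (cong (length H +_) (*-zeroʳ (suc i))) (+-identityʳ (length H)))) }
    ... | inj₂ (T , T⊆H , |T|≡i , ℓ∤⋂T) = record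
      { kept = kept R
      ; kept⊆H = ⊆-trans (kept⊆H R) H-T⊆H
      ; kept-closed = kept-closed R
      ; removed = T ∷ removed R
      ; removed-violations = (T⊆H , |T|≡i , ℓ∤⋂T)
                             ∷ All.map (λ (T′⊆H-T , rest) → ⊆-trans T′⊆H-T H-T⊆H , rest) (removed-violations R)
      ; removed-disjoint = All.map (λ (T′⊆H-T , _) {v} (v∈T , v∈T′) → ∉T (lookup T′⊆H-T v∈T′) v∈T)
                                   (removed-violations R)
                           ∷ removed-disjoint R
      ; size = size′ }
      where
      H-T = filter (¬? ∘ (_∈? T)) H
      H-T⊆H : H-T ⊆ H
      H-T⊆H = filter-⊆ (¬? ∘ (_∈? T)) H
      ∉T : ∀ {a} → a ∈ H-T → ¬ a ∈ T
      ∉T a∈H-T = proj₂ (∈-filter⁻ (¬? ∘ (_∈? T)) {xs = H} a∈H-T)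
      H-T<H : length H-T < length H
      H-T<H = filter-notAll (¬? ∘ (_∈? T)) H
        (Any.map (λ t≡h h∉T → h∉T (subst (_∈ T) t≡h (proj₂ (nonempty |T|≡i)))) (lookup T⊆H (proj₂ (nonempty |T|≡i))))
      R = go H-T (AllPairs-resp-⊆ H-T⊆H H-unique) (shorter H-T<H)
      size′ : length H ≤ length (kept R) + suc i * suc (length (removed R))
      size′ = begin
        length H
          ≡⟨ length-filter+filter-¬ (_∈? T) H ⟨
        length (select T H) + length H-T
          ≤⟨ +-mono-≤ (subst (length (select T H) ≤_) |T|≡i (length-select-≤ {G = T} H-unique)) (size R) ⟩
        suc i + (length (kept R) + suc i * length (removed R))
          ≡⟨ solve 3 (λ i k r → i :+ (k :+ i :* r) := k :+ i :* (con 1 :+ r)) refl (suc i) (length (kept R)) (length (removed R)) ⟩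
        length (kept R) + suc i * suc (length (removed R)) ∎
        where open ≤-Reasoning
              open +-*-Solver

module Descent where

  open import Data.Nat.Base using (ℕ; zero; suc; _≤_; _+_; _*_; _^_; z≤n; NonZero)
  open import Data.Nat.Properties
    using (≤-refl; ≤-trans; m≤m+n; +-monoˡ-≤; +-monoʳ-≤; *-monoˡ-≤; *-monoʳ-≤; n≤1+n; m≤n⇒m<n∨m≡n; module ≤-Reasoning)
  open import Data.Nat.Solver using (module +-*-Solver)
  open import Data.Nat.Divisibility using (_∣_)
  open import Data.Fin.Subset as S using (Subset; ⋂; ∣_∣; _∩_)
  import Data.Fin.Subset.Properties as S
  open import Data.List.Base using (List; []; _∷_; length)
  open import Data.List.Relation.Unary.All as All using (All; []; _∷_)
  open import Data.List.Relation.Unary.AllPairs using (AllPairs; []; _∷_)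
  open import Data.List.Relation.Unary.Any using (here)
  open import Data.List.Relation.Unary.Unique.Propositional using (Unique)
  open import Data.List.Relation.Binary.Sublist.Propositional using (_⊆_; ⊆-refl; ⊆-trans; lookup)
  open import Data.List.Relation.Binary.Disjoint.Propositional using (Disjoint)
  open import Data.List.Membership.Propositional using (_∈_)
  open import Data.Product using (∃; _×_; _,_; proj₁)
  open import Data.Sum using (inj₁; inj₂)
  open import Relation.Nullary using (¬_)
  open import Relation.Binary.PropositionalEquality

  open import Defs
  open PrimePowers
  open ListCombinatorics
  open MarkedFamilies
  open WeakClosure
  open Greedy

  module _ {n ℓ i : ℕ} .{{_ : NonZero ℓ}} {H : List (Subset n)} (H-unique : Unique H)
           (closed : WeaklyClosed (suc (suc i)) ℓ H) where

    extend-violation : ∀ {a T} → Violation (suc i) ℓ H T → a ∈ H → ¬ a ∈ T → ℓ ∣ ∣ ⋂ T ∩ a ∣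
    extend-violation {a} {T} (T⊆H , |T|≡1+i , _) a∈H a∉T =
      subst (λ X → ℓ ∣ ∣ X ∣) (S.∩-comm a (⋂ T))
        (closed (a ∷ T) (cong suc |T|≡1+i)
                (All.tabulate (λ b∈T a≡b → a∉T (subst (_∈ T) (sym a≡b) b∈T)) ∷ AllPairs-resp-⊆ T⊆H H-unique)
                (a∈H ∷ All.tabulate (lookup T⊆H)))

    mark : ∀ {T} → Violation (suc i) ℓ H T → Marked n ℓ
    mark {a ∷ T} (_ , _ , ℓ∤⋂T) =
      let p , e , p-prime , p^e∥⋂T , p^1+e∣ℓ = ∤⇒prime-power-gap ℓ ∣ ⋂ (a ∷ T) ∣ ℓ∤⋂T in record
      { U = ⋂ (a ∷ T) ; A = a ; p = p ; e = e ; p-prime = p-prime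
      ; exact = subst (λ X → p ^ e ∥ ∣ X ∣) (sym (⋂∩-member (a ∷ T) (here refl))) p^e∥⋂T
      ; gap = p^1+e∣ℓ }

    marks-orthogonal : ∀ {T T′} (v : Violation (suc i) ℓ H T) (v′ : Violation (suc i) ℓ H T′) →
                       Disjoint T T′ → Orthogonal (mark v) (mark v′)
    marks-orthogonal {a ∷ T} {a′ ∷ T′} v v′ disjoint =
      extend-violation v (lookup (proj₁ v′) (here refl)) (λ a′∈T → disjoint (a′∈T , here refl)) ,
      extend-violation v′ (lookup (proj₁ v) (here refl)) (λ a∈T′ → disjoint (here refl , a∈T′))

    marks : ∀ {Ts} → All (Violation (suc i) ℓ H) Ts → List (Marked n ℓ)
    marks [] = []
    marks (v ∷ vs) = mark v ∷ marks vs

    length-marks : ∀ {Ts} (vs : All (Violation (suc i) ℓ H) Ts) → length (marks vs) ≡ length Ts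
    length-marks [] = refl
    length-marks (v ∷ vs) = cong suc (length-marks vs)

    marks-orthogonal-all : ∀ {T Ts} (v : Violation (suc i) ℓ H T) (vs : All (Violation (suc i) ℓ H) Ts) →
                           All (Disjoint T) Ts → All (Orthogonal (mark v)) (marks vs)
    marks-orthogonal-all v [] [] = []
    marks-orthogonal-all v (v′ ∷ vs) (d ∷ ds) = marks-orthogonal v v′ d ∷ marks-orthogonal-all v vs ds

    marks-pairwise-orthogonal : ∀ {Ts} (vs : All (Violation (suc i) ℓ H) Ts) →
                                AllPairs Disjoint Ts → AllPairs Orthogonal (marks vs)
    marks-pairwise-orthogonal [] [] = []
    marks-pairwise-orthogonal (v ∷ vs) (ds ∷ dss) = marks-orthogonal-all v vs ds ∷ marks-pairwise-orthogonal vs dss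

    reduction-step : ∃ λ H′ → H′ ⊆ H × WeaklyClosed (suc i) ℓ H′ × length H ≤ length H′ + suc i * (ω ℓ * n)
    reduction-step = kept , kept⊆H , kept-closed , ≤-trans size (+-monoʳ-≤ (length kept) (*-monoʳ-≤ (suc i) removed-bound))
      where
      open Reduction (reduce i ℓ H H-unique)
      removed-bound : length removed ≤ ω ℓ * n
      removed-bound = subst (_≤ ω ℓ * n) (length-marks removed-violations)
        (marked-family-bound (marks removed-violations) (marks-pairwise-orthogonal removed-violations removed-disjoint))

  WeaklyClosedBetween : ∀ {n} → ℕ → ℕ → ℕ → List (Subset n) → Set
  WeaklyClosedBetween j k ℓ H = ∀ t → j ≤ t → t ≤ k → WeaklyClosed t ℓ H

  WeaklyClosedBetween-extend : ∀ {n j k ℓ} {H H′ : List (Subset n)} → H′ ⊆ H →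
    WeaklyClosed j ℓ H′ → WeaklyClosedBetween (suc j) k ℓ H → WeaklyClosedBetween j k ℓ H′
  WeaklyClosedBetween-extend H′⊆H closed-j closed t j≤t t≤k with m≤n⇒m<n∨m≡n j≤t
  ... | inj₁ j<t = WeaklyClosed-resp-⊆ H′⊆H (closed t j<t t≤k)
  ... | inj₂ refl = closed-j

  square-step : ∀ i B {h h₁ h′} → h ≤ h₁ + suc i * B → h₁ ≤ h′ + suc i * suc i * B →
                h ≤ h′ + suc (suc i) * suc (suc i) * B
  square-step i B {h} {h₁} {h′} h≤ h₁≤ = begin
    h                                   ≤⟨ h≤ ⟩
    h₁ + suc i * B                      ≤⟨ +-monoˡ-≤ (suc i * B) h₁≤ ⟩
    h′ + suc i * suc i * B + suc i * B  ≡⟨ solve 3 (λ h′ i B → h′ :+ (con 1 :+ i) :* (con 1 :+ i) :* B :+ (con 1 :+ i) :* B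
                                                           := h′ :+ (con 1 :+ i) :* (con 2 :+ i) :* B) refl h′ i B ⟩
    h′ + suc i * suc (suc i) * B        ≤⟨ +-monoʳ-≤ h′ (*-monoˡ-≤ B (*-monoˡ-≤ (suc (suc i)) (n≤1+n (suc i)))) ⟩
    h′ + suc (suc i) * suc (suc i) * B  ∎
    where open ≤-Reasoning
          open +-*-Solver

  descend : ∀ {n ℓ} .{{_ : NonZero ℓ}} k j → j ≤ k → {H : List (Subset n)} → Unique H → WeaklyClosedBetween j k ℓ H →
            ∃ λ H′ → H′ ⊆ H × WeaklyClosedBetween 1 k ℓ H′ × length H ≤ length H′ + j * j * (ω ℓ * n)
  descend k zero _ {H} _ closed = H , ⊆-refl , (λ t _ → closed t z≤n) , m≤m+n _ _
  descend k (suc zero) _ {H} _ closed = H , ⊆-refl , closed , m≤m+n _ _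
  descend {n} {ℓ} k (suc (suc i)) 2+i≤k {H} H-unique closed =
    let H₁ , H₁⊆H , H₁-closed , |H|≤ = reduction-step H-unique (closed (suc (suc i)) ≤-refl 2+i≤k)
        H′ , H′⊆H₁ , H′-closed , |H₁|≤ = descend k (suc i) (≤-trans (n≤1+n _) 2+i≤k)
          (AllPairs-resp-⊆ H₁⊆H H-unique) (WeaklyClosedBetween-extend H₁⊆H H₁-closed closed)
    in H′ , ⊆-trans H′⊆H₁ H₁⊆H , H′-closed , square-step i (ω ℓ * n) {h′ = length H′} |H|≤ |H₁|≤

open import Defs
open import Data.Nat using (ℕ; _≤_; _+_; _*_)
open import Data.List using (List; length)
open import Data.List.Relation.Unary.Unique.Propositional using (Unique)
open import Data.List.Relation.Binary.Sublist.Propositional using (_⊆_)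
open import Data.Fin.Subset using (Subset)
open import Data.Product using (Σ; _×_)
open import Data.Product using (_,_)
open import Data.Nat.Base using (>-nonZero)
open import Data.Nat.Properties using (≤-refl; ≤-antisym)
open import Data.Nat.Solver using (module +-*-Solver)
open import Relation.Binary.PropositionalEquality using (_≡_; refl; subst)
open ListCombinatorics using (AllPairs-resp-⊆)
open WeakClosure using (weaklyClosed⇒closed)
open Descent using (WeaklyClosedBetween; descend)

lemma4p2 : (n ℓ k : ℕ) → 1 ≤ ℓ → 1 ≤ k → (F : List (Subset n)) → Unique F →
    WeaklyClosed k ℓ F →
    Σ (List (Subset n)) (λ F′ → (F′ ⊆ F) × (length F ≤ length F′ + ω ℓ * k * k * n) × Closed k ℓ F′)
lemma4p2 n ℓ k 1≤ℓ _ F F-unique F-closed =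
  let F′ , F′⊆F , F′-closed , |F|≤ = descend k k ≤-refl F-unique only-k
  in F′ , F′⊆F , subst (λ loss → length F ≤ length F′ + loss) k*k*ωn≡ω*k*k*n |F|≤ ,
     weaklyClosed⇒closed (AllPairs-resp-⊆ F′⊆F F-unique) F′-closed
  where
  instance _ = >-nonZero 1≤ℓ
  only-k : WeaklyClosedBetween k k ℓ F
  only-k t k≤t t≤k = subst (λ t → WeaklyClosed t ℓ F) (≤-antisym k≤t t≤k) F-closed
  k*k*ωn≡ω*k*k*n : k * k * (ω ℓ * n) ≡ ω ℓ * k * k * n
  k*k*ωn≡ω*k*k*n = solve 3 (λ k w n → k :* k :* (w :* n) := w :* k :* k :* n) refl k (ω ℓ) n
    where open +-*-Solver
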